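{- (Lucas' theorem) Let $N\ge1$, $f:\mathbb{N}^N\to\mathbb{N}$, $p$ a prime, and $k=\sum_{j=0}^r k_jp^j$ with $0\le k_j<p$ for $j=0,\dots,r$. Let $\boldsymbol{\ell}\in\mathbb{N}^N$. Then $$\binom{k}{\boldsymbol{\ell}}_f\equiv\sum_{(\mathbf{m}_0,\dots,\mathbf{m}_r)}\prod_{i=0}^r\binom{k_i}{\mathbf{m}_i}_f\pmod p,$$ where the sum is over all $(\mathbf{m}_0,\dots,\mathbf{m}_r)\in(\mathbb{N}^N)^{r+1}$ with $\mathbf{m}_0+\mathbf{m}_1p+\cdots+\mathbf{m}_rp^r=\boldsymbol{\ell}$.
   Context: $\mathbb{N}=\{0,1,2,\dots\}$. For $k\ge0$ and $\boldsymbol{\ell}\in\mathbb{N}^N$, $\binom{k}{\boldsymbol{\ell}}_f=\sum f(\mathbf{m}_1)\cdots f(\mathbf{m}_k)$ over all ordered $k$-tuples of vectors $\mathbf{m}_j\in\mathbb{N}^N$ with $\mathbf{m}_1+\cdots+\mathbf{m}_k=\boldsymbol{\ell}$ (for $k=0$: $1$ if $\boldsymbol{\ell}=\mathbf{0}$, else $0$). -}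

module Defs where

open import Data.Nat using (ℕ; zero; suc; _+_; _*_; _^_)
open import Data.Nat.Properties using (_≟_)
open import Data.List using (List; []; _∷_; [_]; map; concatMap; upTo; filter)
open import Data.Nat.ListAction using (sum; product)
open import Data.Vec using (Vec; []; _∷_; zipWith; replicate; toList; foldr; allFin)
import Data.Vec as V
open import Data.Vec.Properties using (≡-dec)
open import Data.Fin using (Fin; toℕ)

_⊕_ : ∀ {N} → Vec ℕ N → Vec ℕ N → Vec ℕ N
_⊕_ = zipWith _+_

vsum : ∀ {N k} → Vec (Vec ℕ N) k → Vec ℕ N
vsum {N} = foldr _ _⊕_ (replicate N 0)

box : ∀ {N} → Vec ℕ N → List (Vec ℕ N)
box [] = [ [] ]
box (x ∷ v) = concatMap (λ a → map (a ∷_) (box v)) (upTo (suc x))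

tuples : ∀ {A : Set} (k : ℕ) → List A → List (Vec A k)
tuples zero xs = [ [] ]
tuples (suc k) xs = concatMap (λ a → map (a ∷_) (tuples k xs)) xs

_≟v_ : ∀ {N} (u v : Vec ℕ N) → _
_≟v_ = ≡-dec _≟_

-- Every such m_j satisfies m_j ≤ ℓ componentwise, so the
-- tuples are enumerated from (box ℓ)^k and filtered by the sum condition.
binom : ∀ {N} → (Vec ℕ N → ℕ) → ℕ → Vec ℕ N → ℕ
binom f k ℓ =
  sum (map (λ t → product (toList (V.map f t)))
           (filter (λ t → vsum t ≟v ℓ) (tuples k (box ℓ))))

digitValue : ∀ {r} → ℕ → Vec ℕ (suc r) → ℕ
digitValue p ks = sum (toList (zipWith (λ i a → a * p ^ toℕ i) (allFin _) ks))

weightedSum : ∀ {N r} → ℕ → Vec (Vec ℕ N) (suc r) → Vec ℕ N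
weightedSum p ms = vsum (zipWith (λ i m → V.map (p ^ toℕ i *_) m) (allFin _) ms)

-- Σ over (m₀,…,m_r) ∈ (ℕ^N)^{r+1} with m₀ + m₁p + ⋯ + m_r p^r = ℓ of ∏_i binom f k_i m_i.
-- Each such m_i ≤ ℓ componentwise, so tuples are enumerated from (box ℓ)^{r+1}.
lucasRHS : ∀ {N r} → (Vec ℕ N → ℕ) → ℕ → Vec ℕ (suc r) → Vec ℕ N → ℕ
lucasRHS {r = r} f p ks ℓ =
  sum (map (λ ms → product (toList (zipWith (binom f) ks ms)))
           (filter (λ ms → weightedSum p ms ≟v ℓ) (tuples (suc r) (box ℓ))))

module Submission where

-- Work in 𝔽ₚ[[x₁, …, x_N]], built one variable at a time over ℕ modulo p. For the
-- generating series F = Σₘ f(m) xᵐ, the coefficient of x^ℓ in F ^ k is binom f k ℓ.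
-- In characteristic p the freshman's dream gives G ^ p = Frob G, where Frob substitutes
-- xᵢ ↦ xᵢ ^ p and raises coefficients to the p-th power (the identity on 𝔽ₚ by Fermat).
-- Hence F ^ (k₀ + p k₁ + ⋯) = F ^ k₀ · Frob (F ^ k₁ · Frob (⋯)), whose coefficient of x^ℓ
-- is the sum over m₀ + m₁ p + ⋯ + m_r pʳ = ℓ of the products of the binom f kᵢ mᵢ.

open import Defs
open import Algebra.Bundles using (Monoid; CommutativeSemiring)
open import Algebra.Structures.Biased using (IsCommutativeSemiringˡ; IsCommutativeMonoidˡ)
import Algebra.Construct.Pointwise as Pointwise
open import Data.Empty using (⊥-elim)
open import Data.Fin as Fin using (Fin; toℕ; fromℕ; inject₁)
open import Data.Fin.Properties using (toℕ-fromℕ; toℕ-inject₁; toℕ<n)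
open import Data.List as List using (List; []; _∷_; map; concatMap; applyUpTo; filter; _++_)
import Data.List.Properties as Listₚ
open import Data.Nat as ℕ using (ℕ; zero; suc; _∸_; _!; _<_; _≤_; _<?_; z<s; s<s; z≤n; s≤s; NonZero; _%_)
import Data.Nat.Properties as ℕₚ
open import Data.Nat.Combinatorics using (_C_; nCn≡1; k![n∸k]!∣n!)
open import Data.Nat.Combinatorics.Specification using (nCk≡n!/k![n-k]!)
open import Data.Nat.DivMod using (m*n/n≡m; %-distribˡ-+; %-distribˡ-*; m*n%n≡0)
open import Data.Nat.Divisibility using (_∣_; _∤_; _∣?_; divides; quotient; ∣1⇒≡1; ∣⇒≤; m∣m*n; ∣m+n∣m⇒∣n; ∣-refl)
open import Data.Nat.Induction using (<-rec)
open import Data.Nat.Primality using (Prime; prime⇒nonZero; euclidsLemma; ¬prime[1])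
open import Data.Product using (∃; _,_)
open import Data.Sum using (_⊎_; inj₁; inj₂)
open import Data.Vec as Vec using (Vec; []; _∷_)
import Data.Vec.Properties as Vecₚ
open import Data.Vec.Relation.Binary.Pointwise.Inductive as Pointwiseᵥ using (Pointwise; []; _∷_)
open import Data.Vec.Relation.Unary.All as All using (All; []; _∷_)
open import Level using (0ℓ)
open import Relation.Binary.Core using (Rel)
open import Relation.Binary.Structures using (IsEquivalence)
open import Relation.Nullary using (¬_; Dec; yes; no; contradiction)
open import Relation.Unary using (Pred; Decidable)
open import Relation.Binary.PropositionalEquality as ≡ using (_≡_; _≢_)

prime∤! : ∀ {p m} → Prime p → m < p → p ∤ m !
prime∤! {m = zero} isPrime _ p∣1 = ¬prime[1] (≡.subst Prime (∣1⇒≡1 p∣1) isPrime)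
prime∤! {m = suc m} isPrime m<p p∣m! with euclidsLemma (suc m) (m !) isPrime p∣m!
... | inj₁ p∣1+m = ℕₚ.<⇒≱ m<p (∣⇒≤ p∣1+m)
... | inj₂ p∣m!  = prime∤! isPrime (ℕₚ.<-trans (ℕₚ.n<1+n m) m<p) p∣m!

prime∣C : ∀ {p j} → Prime p → 0 < j → j < p → p ∣ p C j
prime∣C {zero} ()
prime∣C {suc n} {j} isPrime 0<j j<p with k![n∸k]!∣n! (ℕₚ.<⇒≤ j<p)
... | divides q p!≡q*D with euclidsLemma q (j ! ℕ.* (suc n ∸ j) !) isPrime (≡.subst (suc n ∣_) p!≡q*D (m∣m*n (n !)))
...   | inj₁ p∣q = ≡.subst (suc n ∣_) (≡.sym C≡q) p∣q
  where
  instance _ = ℕₚ.m*n≢0 (j !) ((suc n ∸ j) !) {{ℕₚ._!≢0 j}} {{ℕₚ._!≢0 (suc n ∸ j)}}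
  C≡q : suc n C j ≡ q
  C≡q = ≡.trans (nCk≡n!/k![n-k]! (ℕₚ.<⇒≤ j<p)) (≡.trans (≡.cong (ℕ._/ _) p!≡q*D) (m*n/n≡m q _))
...   | inj₂ p∣D with euclidsLemma (j !) ((suc n ∸ j) !) isPrime p∣D
...     | inj₁ p∣j! = ⊥-elim (prime∤! isPrime j<p p∣j!)
...     | inj₂ p∣[p∸j]! = ⊥-elim (prime∤! isPrime (ℕₚ.∸-monoʳ-< 0<j (ℕₚ.<⇒≤ j<p)) p∣[p∸j]!)

module CharacteristicSemiring {c ℓ} (R : CommutativeSemiring c ℓ) where

  open CommutativeSemiring R
  open import Algebra.Properties.Semiring.Mult semiring
  open import Algebra.Properties.Semiring.Exp semiring
  open import Algebra.Properties.Semiring.Sum semiring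
  open import Relation.Binary.Reasoning.Setoid setoid

  HasCharacteristic : ℕ → Set _
  HasCharacteristic p = ∀ x → p × x ≈ 0#

  ×-zeroʳ : ∀ n → n × 0# ≈ 0#
  ×-zeroʳ zero = refl
  ×-zeroʳ (suc n) = trans (+-identityˡ _) (×-zeroʳ n)

  ∣⇒×≈0 : ∀ {p n} → HasCharacteristic p → p ∣ n → ∀ x → n × x ≈ 0#
  ∣⇒×≈0 {p} char (divides q ≡.refl) x = begin
    (q ℕ.* p) × x ≈⟨ ×-assocˡ x q p ⟨
    q × (p × x)   ≈⟨ ×-congʳ q (char x) ⟩
    q × 0#        ≈⟨ ×-zeroʳ q ⟩
    0#            ∎

  freshmansDream : ∀ {p} → Prime p → HasCharacteristic p → ∀ x y → (x + y) ^ p ≈ x ^ p + y ^ p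
  freshmansDream {zero} ()
  freshmansDream {suc q} isPrime char x y = begin
    (x + y) ^ p                                                        ≈⟨ theorem (*-comm x y) p ⟩
    binomialTerm p Fin.zero + sum (λ i → binomialTerm p (Fin.suc i))  ≈⟨ +-congˡ (sum-init-last (λ i → binomialTerm p (Fin.suc i))) ⟩
    binomialTerm p Fin.zero + (sum (λ i → binomialTerm p (Fin.suc (inject₁ i))) + binomialTerm p (Fin.suc (fromℕ q)))
      ≈⟨ +-cong first (+-cong (trans (sum-cong-≋ middle) (sum-replicate-zero q)) last) ⟩
    y ^ p + (0# + x ^ p)                                               ≈⟨ +-comm _ _ ⟩
    (0# + x ^ p) + y ^ p                                               ≈⟨ +-congʳ (+-identityˡ _) ⟩
    x ^ p + y ^ p                                                      ∎
    where
    p = suc q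
    open import Algebra.Properties.Semiring.Binomial semiring x y
    first : binomialTerm p Fin.zero ≈ y ^ p
    first = trans (×-homo-1 _) (*-identityˡ _)
    middle : ∀ i → binomialTerm p (Fin.suc (inject₁ i)) ≈ 0#
    middle i = ∣⇒×≈0 char (prime∣C isPrime z<s (s<s (≡.subst (_< q) (≡.sym (toℕ-inject₁ i)) (toℕ<n i)))) _
    last : binomialTerm p (Fin.suc (fromℕ q)) ≈ x ^ p
    last rewrite toℕ-fromℕ q | nCn≡1 p | ℕₚ.n∸n≡0 p = trans (×-homo-1 _) (*-identityʳ _)

module RangeSum {c ℓ} (M : Monoid c ℓ) where

  open Monoid M

  ∑< : ℕ → (ℕ → Carrier) → Carrier
  ∑< zero    G = ε
  ∑< (suc n) G = G 0 ∙ ∑< n (λ a → G (suc a))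

  infix 5 ∑<
  syntax ∑< n (λ a → e) = ∑<[ a < n ] e

  ∑<-cong : ∀ n {G H} → (∀ a → a < n → G a ≈ H a) → ∑< n G ≈ ∑< n H
  ∑<-cong zero    G≈H = refl
  ∑<-cong (suc n) G≈H = ∙-cong (G≈H 0 z<s) (∑<-cong n λ a a<n → G≈H (suc a) (s<s a<n))

  ∑<-zero : ∀ n {G} → (∀ a → G a ≈ ε) → ∑< n G ≈ ε
  ∑<-zero zero    G≈ε = refl
  ∑<-zero (suc n) G≈ε = trans (∙-cong (G≈ε 0) (∑<-zero n λ a → G≈ε (suc a))) (identityˡ ε)

  ∑<-support : ∀ {x y G} → y ≤ x → (∀ a → y < a → G a ≈ ε) → ∑< (suc x) G ≈ ∑< (suc y) G
  ∑<-support {x}     {zero}  {G} z≤n       G≈ε = ∙-congˡ (∑<-zero x λ a → G≈ε (suc a) z<s)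
  ∑<-support {suc x} {suc y} {G} (s≤s y≤x) G≈ε = ∙-congˡ (∑<-support y≤x λ a y<a → G≈ε (suc a) (s<s y<a))

module PowerSeries {c ℓ} (R : CommutativeSemiring c ℓ) where

  open CommutativeSemiring R
  open import Algebra.Properties.Semiring.Mult semiring using (_×_)
  open import Algebra.Properties.Semiring.Exp semiring using (_^_)
  open import Algebra.Properties.CommutativeSemigroup +-commutativeSemigroup using (interchange; x∙yz≈y∙xz)
  open import Relation.Binary.Reasoning.Setoid setoid
  open CharacteristicSemiring using (HasCharacteristic)

  Series : Set c
  Series = ℕ → Carrier

  infix 4 _≋_
  _≋_ : Series → Series → Set ℓ
  f ≋ g = ∀ n → f n ≈ g n

  infixl 6 _+ₛ_
  _+ₛ_ : Series → Series → Series
  (f +ₛ g) n = f n + g n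

  0ₛ : Series
  0ₛ _ = 0#

  1ₛ : Series
  1ₛ zero    = 1#
  1ₛ (suc n) = 0#

  tail : Series → Series
  tail f n = f (suc n)

  -- The Cauchy product, recursing on the first factor: f = f 0 + X · tail f.
  infixl 7 _*ₛ_
  _*ₛ_ : Series → Series → Series
  (f *ₛ g) zero    = f 0 * g 0
  (f *ₛ g) (suc n) = f 0 * g (suc n) + (tail f *ₛ g) n

  _·_ : Carrier → Series → Series
  (a · f) n = a * f n

  *ₛ-cong : ∀ {f f′ g g′} → f ≋ f′ → g ≋ g′ → f *ₛ g ≋ f′ *ₛ g′
  *ₛ-cong f≋f′ g≋g′ zero    = *-cong (f≋f′ 0) (g≋g′ 0)
  *ₛ-cong f≋f′ g≋g′ (suc n) = +-cong (*-cong (f≋f′ 0) (g≋g′ (suc n))) (*ₛ-cong (λ m → f≋f′ (suc m)) g≋g′ n)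

  *ₛ-zeroˡ : ∀ g → 0ₛ *ₛ g ≋ 0ₛ
  *ₛ-zeroˡ g zero    = zeroˡ _
  *ₛ-zeroˡ g (suc n) = trans (+-cong (zeroˡ _) (*ₛ-zeroˡ g n)) (+-identityˡ _)

  *ₛ-identityˡ : ∀ g → 1ₛ *ₛ g ≋ g
  *ₛ-identityˡ g zero    = *-identityˡ _
  *ₛ-identityˡ g (suc n) = trans (+-cong (*-identityˡ _) (*ₛ-zeroˡ g n)) (+-identityʳ _)

  *ₛ-distribʳ : ∀ h f g → (f +ₛ g) *ₛ h ≋ f *ₛ h +ₛ g *ₛ h
  *ₛ-distribʳ h f g zero    = distribʳ _ _ _
  *ₛ-distribʳ h f g (suc n) = trans (+-cong (distribʳ _ _ _) (*ₛ-distribʳ h (tail f) (tail g) n)) (interchange _ _ _ _)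

  ·-*ₛ-assoc : ∀ a f g → (a · f) *ₛ g ≋ a · (f *ₛ g)
  ·-*ₛ-assoc a f g zero    = *-assoc _ _ _
  ·-*ₛ-assoc a f g (suc n) = trans (+-cong (*-assoc _ _ _) (·-*ₛ-assoc a (tail f) g n)) (sym (distribˡ _ _ _))

  *ₛ-suc-tailʳ : ∀ f g n → (f *ₛ g) (suc n) ≈ f (suc n) * g 0 + (f *ₛ tail g) n
  *ₛ-suc-tailʳ f g zero    = +-comm _ _
  *ₛ-suc-tailʳ f g (suc n) = begin
    f 0 * g (suc (suc n)) + (tail f *ₛ g) (suc n)                         ≈⟨ +-congˡ (*ₛ-suc-tailʳ (tail f) g n) ⟩
    f 0 * g (suc (suc n)) + (f (suc (suc n)) * g 0 + (tail f *ₛ tail g) n) ≈⟨ x∙yz≈y∙xz _ _ _ ⟩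
    f (suc (suc n)) * g 0 + (f 0 * g (suc (suc n)) + (tail f *ₛ tail g) n) ∎

  *ₛ-comm : ∀ f g → f *ₛ g ≋ g *ₛ f
  *ₛ-comm f g zero    = *-comm _ _
  *ₛ-comm f g (suc n) = begin
    f 0 * g (suc n) + (tail f *ₛ g) n ≈⟨ +-cong (*-comm _ _) (*ₛ-comm (tail f) g n) ⟩
    g (suc n) * f 0 + (g *ₛ tail f) n ≈⟨ *ₛ-suc-tailʳ g f n ⟨
    (g *ₛ f) (suc n)                  ∎

  *ₛ-assoc : ∀ f g h → (f *ₛ g) *ₛ h ≋ f *ₛ (g *ₛ h)
  *ₛ-assoc f g h zero    = *-assoc _ _ _
  *ₛ-assoc f g h (suc n) = begin
    (f 0 * g 0) * h (suc n) + ((f 0 · tail g +ₛ tail f *ₛ g) *ₛ h) n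
      ≈⟨ +-cong (*-assoc _ _ _) (*ₛ-distribʳ h (f 0 · tail g) (tail f *ₛ g) n) ⟩
    f 0 * (g 0 * h (suc n)) + (((f 0 · tail g) *ₛ h) n + ((tail f *ₛ g) *ₛ h) n)
      ≈⟨ +-congˡ (+-cong (·-*ₛ-assoc (f 0) (tail g) h n) (*ₛ-assoc (tail f) g h n)) ⟩
    f 0 * (g 0 * h (suc n)) + (f 0 * (tail g *ₛ h) n + (tail f *ₛ (g *ₛ h)) n)
      ≈⟨ +-assoc _ _ _ ⟨
    (f 0 * (g 0 * h (suc n)) + f 0 * (tail g *ₛ h) n) + (tail f *ₛ (g *ₛ h)) n
      ≈⟨ +-congʳ (distribˡ _ _ _) ⟨
    f 0 * (g 0 * h (suc n) + (tail g *ₛ h) n) + (tail f *ₛ (g *ₛ h)) n ∎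

  open RangeSum +-monoid using (∑<)

  *ₛ-coefficient : ∀ f g n → (f *ₛ g) n ≈ ∑<[ a < suc n ] f a * g (n ∸ a)
  *ₛ-coefficient f g zero    = sym (+-identityʳ _)
  *ₛ-coefficient f g (suc n) = +-congˡ (*ₛ-coefficient (tail f) g n)

  powerSeries : CommutativeSemiring c ℓ
  powerSeries = record
    { isCommutativeSemiring = IsCommutativeSemiringˡ.isCommutativeSemiring record
      { +-isCommutativeMonoid = Pointwise.isCommutativeMonoid ℕ +-isCommutativeMonoid
      ; *-isCommutativeMonoid = IsCommutativeMonoidˡ.isCommutativeMonoid record
        { isSemigroup = record
          { isMagma = record { isEquivalence = Pointwise.isEquivalence ℕ isEquivalence ; ∙-cong = *ₛ-cong }
          ; assoc   = *ₛ-assoc }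
        ; identityˡ = *ₛ-identityˡ
        ; comm      = *ₛ-comm }
      ; distribʳ = *ₛ-distribʳ
      ; zeroˡ    = *ₛ-zeroˡ } }

  module S where
    open import Algebra.Properties.Semiring.Mult (CommutativeSemiring.semiring powerSeries) public using (_×_)
    open import Algebra.Properties.Semiring.Exp (CommutativeSemiring.semiring powerSeries) public using (_^_; ^-congˡ)

  ×ₛ-coefficient : ∀ n G m → (n S.× G) m ≈ n × G m
  ×ₛ-coefficient zero    G m = refl
  ×ₛ-coefficient (suc n) G m = +-congˡ (×ₛ-coefficient n G m)

  powerSeries-characteristic : ∀ {p} → HasCharacteristic R p → HasCharacteristic powerSeries p
  powerSeries-characteristic {p} char G m = trans (×ₛ-coefficient p G m) (char (G m))

  constant : Carrier → Series
  constant a zero    = a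
  constant a (suc n) = 0#

  shift : Series → Series
  shift h zero    = 0#
  shift h (suc n) = h n

  shift^ : ℕ → Series → Series
  shift^ zero    h = h
  shift^ (suc k) h = shift (shift^ k h)

  shift-cong : ∀ {f g} → f ≋ g → shift f ≋ shift g
  shift-cong f≋g zero    = refl
  shift-cong f≋g (suc n) = f≋g n

  shift^-cong : ∀ k {f g} → f ≋ g → shift^ k f ≋ shift^ k g
  shift^-cong zero    f≋g = f≋g
  shift^-cong (suc k) f≋g = shift-cong (shift^-cong k f≋g)

  shift-*ₛ : ∀ f g → shift f *ₛ g ≋ shift (f *ₛ g)
  shift-*ₛ f g zero    = zeroˡ _
  shift-*ₛ f g (suc n) = trans (+-congʳ (zeroˡ _)) (+-identityˡ _)

  shift^-*ₛ : ∀ k f g → shift^ k f *ₛ g ≋ shift^ k (f *ₛ g)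
  shift^-*ₛ zero    f g n = refl
  shift^-*ₛ (suc k) f g n = trans (shift-*ₛ (shift^ k f) g n) (shift-cong (shift^-*ₛ k f g) n)

  shift-^ : ∀ k f → shift f S.^ k ≋ shift^ k (f S.^ k)
  shift-^ zero    f n = refl
  shift-^ (suc k) f n = begin
    (shift f *ₛ shift f S.^ k) n           ≈⟨ *ₛ-cong {shift f} (λ _ → refl) (shift-^ k f) n ⟩
    (shift f *ₛ shift^ k (f S.^ k)) n      ≈⟨ shift-*ₛ f _ n ⟩
    shift (f *ₛ shift^ k (f S.^ k)) n      ≈⟨ shift-cong (λ m → *ₛ-comm f _ m) n ⟩
    shift (shift^ k (f S.^ k) *ₛ f) n      ≈⟨ shift-cong (shift^-*ₛ k _ f) n ⟩
    shift (shift^ k (f S.^ k *ₛ f)) n      ≈⟨ shift-cong (shift^-cong k (λ m → *ₛ-comm _ f m)) n ⟩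
    shift^ (suc k) (f S.^ suc k) n         ∎

  shift^-+ : ∀ k h j → shift^ k h (k ℕ.+ j) ≡ h j
  shift^-+ zero    h j = ≡.refl
  shift^-+ (suc k) h j = shift^-+ k h j

  shift^-below : ∀ k h {m} → m < k → shift^ k h m ≡ 0#
  shift^-below (suc k) h {zero}  _         = ≡.refl
  shift^-below (suc k) h {suc m} (s<s m<k) = shift^-below k h m<k

  constant-positive : ∀ a {n} → 0 < n → constant a n ≡ 0#
  constant-positive a {suc n} _ = ≡.refl

  constant-*ₛ : ∀ a b → constant a *ₛ constant b ≋ constant (a * b)
  constant-*ₛ a b zero    = refl
  constant-*ₛ a b (suc n) = trans (+-cong (zeroʳ _) (*ₛ-zeroˡ (constant b) n)) (+-identityˡ _)

  constant-^ : ∀ k a → constant a S.^ k ≋ constant (a ^ k)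
  constant-^ zero    a zero    = refl
  constant-^ zero    a (suc n) = refl
  constant-^ (suc k) a n = trans (*ₛ-cong {constant a} (λ _ → refl) (constant-^ k a) n) (constant-*ₛ a _ n)

  constant+shift : ∀ G → G ≋ constant (G 0) +ₛ shift (tail G)
  constant+shift G zero    = sym (+-identityʳ _)
  constant+shift G (suc n) = sym (+-identityˡ _)


module Dilation (p : ℕ) .{{_ : NonZero p}} where

  open import Data.Product using (_×_)

  dilate : ∀ {a} {A : Set a} → A → (ℕ → A) → ℕ → A
  dilate z h n with p ∣? n
  ... | yes p∣n = h (quotient p∣n)
  ... | no  _   = z

  module _ {a} {A : Set a} (z : A) (h : ℕ → A) where

    dilate-view : ∀ n → (∃ λ q → n ≡ q ℕ.* p × dilate z h n ≡ h q) ⊎ (p ∤ n × dilate z h n ≡ z)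
    dilate-view n with p ∣? n
    ... | yes (divides q n≡q*p) = inj₁ (q , n≡q*p , ≡.refl)
    ... | no  p∤n               = inj₂ (p∤n , ≡.refl)

    dilate-multiple : ∀ q → dilate z h (q ℕ.* p) ≡ h q
    dilate-multiple q with dilate-view (q ℕ.* p)
    ... | inj₁ (q′ , q*p≡q′*p , value) = ≡.trans value (≡.cong h (ℕₚ.*-cancelʳ-≡ q′ q p (≡.sym q*p≡q′*p)))
    ... | inj₂ (p∤q*p , _)              = contradiction (divides q ≡.refl) p∤q*p

    dilate-nonmultiple : ∀ {n} → p ∤ n → dilate z h n ≡ z
    dilate-nonmultiple {n} p∤n with dilate-view n
    ... | inj₁ (q , ≡.refl , _) = contradiction (divides q ≡.refl) p∤n
    ... | inj₂ (_ , value)    = value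

  dilate-below : ∀ {a} {A : Set a} (z : A) h {n} → 0 < n → n < p → dilate z h n ≡ z
  dilate-below z h 0<n n<p = dilate-nonmultiple z h λ p∣n → ℕₚ.<⇒≱ n<p (∣⇒≤ {{ℕ.>-nonZero 0<n}} p∣n)

  dilate-+p : ∀ {a} {A : Set a} (z : A) h j → dilate z h (p ℕ.+ j) ≡ dilate z (λ q → h (suc q)) j
  dilate-+p z h j with dilate-view z (λ q → h (suc q)) j
  ... | inj₁ (q , ≡.refl , value) = ≡.trans (dilate-multiple z h (suc q)) (≡.sym value)
  ... | inj₂ (p∤j , value)      = ≡.trans (dilate-nonmultiple z h (λ p∣p+j → p∤j (∣m+n∣m⇒∣n p∣p+j ∣-refl))) (≡.sym value)

  dilate-pointwise : ∀ {a b x} {A : Set a} {B : Set b} {X : Set x} (z : A) (h : ℕ → X → A) (F : (X → A) → B) n →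
                     F (λ x → dilate z (λ q → h q x) n) ≡ dilate (F (λ _ → z)) (λ q → F (h q)) n
  dilate-pointwise z h F n with p ∣? n
  ... | yes _ = ≡.refl
  ... | no  _ = ≡.refl

  dilate-cong : ∀ {a r} {A : Set a} (_∼_ : Rel A r) {z z′ h h′} → z ∼ z′ → (∀ q → h q ∼ h′ q) →
                ∀ n → dilate z h n ∼ dilate z′ h′ n
  dilate-cong _∼_ z∼z′ h∼h′ n with p ∣? n
  ... | yes p∣n = h∼h′ (quotient p∣n)
  ... | no  _   = z∼z′

module PowerSeriesFrobenius {c ℓ} (R : CommutativeSemiring c ℓ) {p : ℕ} (isPrime : Prime p)
                            (char : CharacteristicSemiring.HasCharacteristic R p) where

  private instance p≢0 = prime⇒nonZero isPrime
  open CommutativeSemiring R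
  open PowerSeries R
  open import Algebra.Properties.Semiring.Exp semiring using (_^_)
  open CharacteristicSemiring powerSeries using (freshmansDream)
  open Dilation p
  open import Relation.Binary.Reasoning.Setoid setoid

  0<p : 0 < p
  0<p = ℕ.>-nonZero⁻¹ p

  ^p-split : ∀ G → G S.^ p ≋ constant (G 0 ^ p) +ₛ shift^ p (tail G S.^ p)
  ^p-split G n = begin
    (G S.^ p) n                                                 ≈⟨ S.^-congˡ p (constant+shift G) n ⟩
    ((constant (G 0) +ₛ shift (tail G)) S.^ p) n                ≈⟨ freshmansDream isPrime (powerSeries-characteristic {p} char) _ _ n ⟩
    (constant (G 0) S.^ p) n + (shift (tail G) S.^ p) n         ≈⟨ +-cong (constant-^ p (G 0) n) (shift-^ p (tail G) n) ⟩
    constant (G 0 ^ p) n + shift^ p (tail G S.^ p) n            ∎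

  -- G ^ p = (G 0) ^ p + X ^ p · (tail G) ^ p by the freshman's dream; induct on the coefficient index.
  ^p-coefficient : ∀ n G → (G S.^ p) n ≈ dilate 0# (λ j → G j ^ p) n
  ^p-coefficient = <-rec _ step
    where
    step : ∀ n → (∀ {m} → m < n → ∀ G → (G S.^ p) m ≈ dilate 0# (λ j → G j ^ p) m) →
           ∀ G → (G S.^ p) n ≈ dilate 0# (λ j → G j ^ p) n
    step n rec G with n <? p
    ... | yes n<p = trans (^p-split G n) (trans (+-congˡ (reflexive (shift^-below p _ n<p))) (trans (+-identityʳ _) (low n n<p)))
      where
      low : ∀ n → n < p → constant (G 0 ^ p) n ≈ dilate 0# (λ j → G j ^ p) n
      low zero    _   = reflexive (≡.sym (dilate-multiple 0# (λ j → G j ^ p) 0))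
      low (suc m) m<p = reflexive (≡.sym (dilate-below 0# (λ j → G j ^ p) z<s m<p))
    ... | no n≮p = ≡.subst (λ n → (G S.^ p) n ≈ dilate 0# (λ j → G j ^ p) n) (ℕₚ.m+[n∸m]≡n p≤n) (begin
      (G S.^ p) (p ℕ.+ j)                                                ≈⟨ ^p-split G (p ℕ.+ j) ⟩
      constant (G 0 ^ p) (p ℕ.+ j) + shift^ p (tail G S.^ p) (p ℕ.+ j)
        ≈⟨ +-cong (reflexive (constant-positive _ (ℕₚ.<-≤-trans 0<p (ℕₚ.m≤m+n p j)))) (reflexive (shift^-+ p _ j)) ⟩
      0# + (tail G S.^ p) j                                              ≈⟨ +-identityˡ _ ⟩
      (tail G S.^ p) j                                                   ≈⟨ rec (ℕₚ.∸-monoʳ-< 0<p p≤n) (tail G) ⟩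
      dilate 0# (λ i → G (suc i) ^ p) j                                  ≡⟨ dilate-+p 0# (λ i → G i ^ p) j ⟨
      dilate 0# (λ i → G i ^ p) (p ℕ.+ j)                                ∎)
      where
      p≤n = ℕₚ.≮⇒≥ n≮p
      j = n ∸ p

module _ (p : ℕ) .{{_ : NonZero p}} where

  infix 4 _≡[mod]_
  _≡[mod]_ : ℕ → ℕ → Set
  a ≡[mod] b = a % p ≡ b % p

  private
    lift : ∀ {a b} → a ≡ b → a ≡[mod] b
    lift = ≡.cong (_% p)

    +-cong-mod : ∀ {a b c d} → a ≡[mod] b → c ≡[mod] d → a ℕ.+ c ≡[mod] b ℕ.+ d
    +-cong-mod {a} {b} {c} {d} a≡b c≡d = ≡.trans (%-distribˡ-+ a c p)
      (≡.trans (≡.cong₂ (λ x y → (x ℕ.+ y) % p) a≡b c≡d) (≡.sym (%-distribˡ-+ b d p)))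

    *-cong-mod : ∀ {a b c d} → a ≡[mod] b → c ≡[mod] d → a ℕ.* c ≡[mod] b ℕ.* d
    *-cong-mod {a} {b} {c} {d} a≡b c≡d = ≡.trans (%-distribˡ-* a c p)
      (≡.trans (≡.cong₂ (λ x y → (x ℕ.* y) % p) a≡b c≡d) (≡.sym (%-distribˡ-* b d p)))

    isEquivalence : IsEquivalence _≡[mod]_
    isEquivalence = record { refl = ≡.refl ; sym = ≡.sym ; trans = ≡.trans }

  ℕ/p : CommutativeSemiring 0ℓ 0ℓ
  ℕ/p = record { isCommutativeSemiring = IsCommutativeSemiringˡ.isCommutativeSemiring record
    { +-isCommutativeMonoid = record
      { isMonoid = record
        { isSemigroup = record
          { isMagma = record { isEquivalence = isEquivalence ; ∙-cong = +-cong-mod }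
          ; assoc   = λ x y z → lift (ℕₚ.+-assoc x y z) }
        ; identity = (λ x → lift (ℕₚ.+-identityˡ x)) , (λ x → lift (ℕₚ.+-identityʳ x)) }
      ; comm = λ x y → lift (ℕₚ.+-comm x y) }
    ; *-isCommutativeMonoid = record
      { isMonoid = record
        { isSemigroup = record
          { isMagma = record { isEquivalence = isEquivalence ; ∙-cong = *-cong-mod }
          ; assoc   = λ x y z → lift (ℕₚ.*-assoc x y z) }
        ; identity = (λ x → lift (ℕₚ.*-identityˡ x)) , (λ x → lift (ℕₚ.*-identityʳ x)) }
      ; comm = λ x y → lift (ℕₚ.*-comm x y) }
    ; distribʳ = λ x y z → lift (ℕₚ.*-distribʳ-+ x y z)
    ; zeroˡ    = λ x → ≡.refl } }

module _ {p : ℕ} (isPrime : Prime p) where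

  private instance p≢0 = prime⇒nonZero isPrime
  open CommutativeSemiring (ℕ/p p)
  open import Algebra.Properties.Semiring.Mult semiring using (_×_)
  open import Algebra.Properties.Semiring.Exp semiring using (_^_; ^-congˡ; ^-congʳ)
  open CharacteristicSemiring (ℕ/p p) using (HasCharacteristic; freshmansDream)

  ×≡* : ∀ n x → n × x ≡ n ℕ.* x
  ×≡* zero    x = ≡.refl
  ×≡* (suc n) x = ≡.cong (x ℕ.+_) (×≡* n x)

  ℕ/p-characteristic : HasCharacteristic p
  ℕ/p-characteristic x = begin
    (p × x) % p   ≡⟨ ≡.cong (_% p) (≡.trans (×≡* p x) (ℕₚ.*-comm p x)) ⟩
    (x ℕ.* p) % p ≡⟨ m*n%n≡0 x p ⟩
    0             ≡⟨ m*n%n≡0 0 p ⟨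
    0 % p         ∎
    where open ≡.≡-Reasoning

  1^n≡1 : ∀ n → 1 ^ n ≡ 1
  1^n≡1 zero    = ≡.refl
  1^n≡1 (suc n) = ≡.trans (ℕₚ.+-identityʳ (1 ^ n)) (1^n≡1 n)

  fermat : ∀ x → x ^ p ≈ x
  fermat zero    = trans (^-congʳ 0 (≡.sym (ℕₚ.suc-pred p))) refl
  fermat (suc x) = begin
    suc x ^ p        ≈⟨ ^-congˡ p (≡.cong (_% p) (ℕₚ.+-comm 1 x)) ⟩
    (x ℕ.+ 1) ^ p    ≈⟨ freshmansDream isPrime ℕ/p-characteristic x 1 ⟩
    x ^ p ℕ.+ 1 ^ p  ≈⟨ +-cong (fermat x) (reflexive (1^n≡1 p)) ⟩
    x ℕ.+ 1          ≈⟨ ≡.cong (_% p) (ℕₚ.+-comm x 1) ⟩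
    suc x            ∎
    where open import Relation.Binary.Reasoning.Setoid setoid

module MultivariateSeries {p : ℕ} (isPrime : Prime p) where

  private instance p≢0 = prime⇒nonZero isPrime
  open Dilation p
  open CharacteristicSemiring using (HasCharacteristic)

  𝔽[[_]] : ℕ → CommutativeSemiring 0ℓ 0ℓ
  𝔽[[ zero ]]  = ℕ/p p
  𝔽[[ suc N ]] = PowerSeries.powerSeries 𝔽[[ N ]]

  module 𝔽 (N : ℕ) where
    open CommutativeSemiring 𝔽[[ N ]] public
    open import Algebra.Properties.Semiring.Exp semiring public using (_^_; ^-congˡ; ^-congʳ; ^-homo-*; ^-assocʳ)

  frobenius : ∀ N → 𝔽.Carrier N → 𝔽.Carrier N
  frobenius zero    x = x
  frobenius (suc N) G = dilate (𝔽.0# N) (λ j → frobenius N (G j))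

  characteristic : ∀ N → HasCharacteristic 𝔽[[ N ]] p
  characteristic zero    = ℕ/p-characteristic isPrime
  characteristic (suc N) = PowerSeries.powerSeries-characteristic 𝔽[[ N ]] {p} (characteristic N)

  ^p≈frobenius : ∀ N x → 𝔽._≈_ N (𝔽._^_ N x p) (frobenius N x)
  ^p≈frobenius zero    = fermat isPrime
  ^p≈frobenius (suc N) G n = trans (^p-coefficient n G) (dilate-cong _≈_ refl (λ j → ^p≈frobenius N (G j)) n)
    where
    open 𝔽 N
    open PowerSeriesFrobenius 𝔽[[ N ]] isPrime (characteristic N)

module _ where

  open import Data.Nat using (_+_; _*_; _^_)
  open ≡ using (refl; cong; cong₂; sym; trans; subst)
  open ≡.≡-Reasoning
  open import Algebra.Properties.CommutativeSemigroup ℕₚ.*-commutativeSemigroup using (x∙yz≈y∙xz)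
  open import Data.Nat.Tactic.RingSolver using (solve-∀)
  open import Data.Product using (_×_)
  open import Data.Nat.ListAction using (sum; product)
  open import Data.Nat.ListAction.Properties using (sum-++)

  𝟙[_] : ∀ {a} {P : Set a} → Dec P → ℕ
  𝟙[ yes _ ] = 1
  𝟙[ no  _ ] = 0

  𝟙-reject : ∀ {a} {P : Set a} (P? : Dec P) → ¬ P → 𝟙[ P? ] ≡ 0
  𝟙-reject (yes p) ¬p = contradiction p ¬p
  𝟙-reject (no  _) _  = refl

  𝟙-cong : ∀ {a b} {P : Set a} {Q : Set b} (P? : Dec P) (Q? : Dec Q) → (P → Q) → (Q → P) → 𝟙[ P? ] ≡ 𝟙[ Q? ]
  𝟙-cong (yes _) (yes _) _   _   = refl
  𝟙-cong (yes p) (no ¬q) P→Q _   = contradiction (P→Q p) ¬q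
  𝟙-cong (no ¬p) (yes q) _   Q→P = contradiction (Q→P q) ¬p
  𝟙-cong (no  _) (no  _) _   _   = refl

  ∑ : ∀ {a} {A : Set a} → List A → (A → ℕ) → ℕ
  ∑ xs f = sum (map f xs)

  infix 5 ∑
  syntax ∑ xs (λ x → e) = ∑[ x ∈ xs ] e

  module _ {a} {A : Set a} where

    ∑-cong : ∀ xs {f g : A → ℕ} → (∀ x → f x ≡ g x) → ∑ xs f ≡ ∑ xs g
    ∑-cong xs f≗g = cong sum (Listₚ.map-cong f≗g xs)

    ∑-zero : ∀ xs {f : A → ℕ} → (∀ x → f x ≡ 0) → ∑ xs f ≡ 0
    ∑-zero []       f≗0 = refl
    ∑-zero (x ∷ xs) f≗0 = cong₂ _+_ (f≗0 x) (∑-zero xs f≗0)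

    ∑-*ˡ : ∀ xs c (f : A → ℕ) → ∑[ x ∈ xs ] c * f x ≡ c * ∑ xs f
    ∑-*ˡ []       c f = sym (ℕₚ.*-zeroʳ c)
    ∑-*ˡ (x ∷ xs) c f = trans (cong (c * f x +_) (∑-*ˡ xs c f)) (sym (ℕₚ.*-distribˡ-+ c (f x) (∑ xs f)))

    ∑-filter : ∀ {p} {P : Pred A p} (P? : Decidable P) xs (f : A → ℕ) → ∑ (filter P? xs) f ≡ ∑[ x ∈ xs ] 𝟙[ P? x ] * f x
    ∑-filter P? []       f = refl
    ∑-filter P? (x ∷ xs) f with P? x
    ... | yes _ = cong₂ _+_ (sym (ℕₚ.+-identityʳ (f x))) (∑-filter P? xs f)
    ... | no  _ = ∑-filter P? xs f

    ∑-concatMap : ∀ {b c} {B : Set b} {C : Set c} (g : A → B → C) (ys : List B) xs (h : C → ℕ) →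
                  ∑ (concatMap (λ x → map (g x) ys) xs) h ≡ ∑[ x ∈ xs ] ∑[ y ∈ ys ] h (g x y)
    ∑-concatMap g ys []       h = refl
    ∑-concatMap g ys (x ∷ xs) h = begin
      sum (map h (map (g x) ys ++ concatMap (λ x → map (g x) ys) xs))        ≡⟨ cong sum (Listₚ.map-++ h (map (g x) ys) _) ⟩
      sum (map h (map (g x) ys) ++ map h (concatMap (λ x → map (g x) ys) xs)) ≡⟨ sum-++ (map h (map (g x) ys)) _ ⟩
      sum (map h (map (g x) ys)) + ∑ (concatMap (λ x → map (g x) ys) xs) h
        ≡⟨ cong₂ _+_ (cong sum (sym (Listₚ.map-∘ ys))) (∑-concatMap g ys xs h) ⟩
      (∑[ y ∈ ys ] h (g x y)) + (∑[ x ∈ xs ] ∑[ y ∈ ys ] h (g x y))          ∎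

  ∑-tuples-suc : ∀ {A : Set} k xs (W : Vec A (suc k) → ℕ) → ∑ (tuples (suc k) xs) W ≡ ∑[ x ∈ xs ] ∑[ t ∈ tuples k xs ] W (x ∷ t)
  ∑-tuples-suc k xs W = ∑-concatMap _∷_ (tuples k xs) xs W

  open RangeSum ℕₚ.+-0-monoid public

  ∑-applyUpTo : ∀ n (g : ℕ → ℕ) (G : ℕ → ℕ) → ∑ (applyUpTo g n) G ≡ ∑<[ a < n ] G (g a)
  ∑-applyUpTo zero    g G = refl
  ∑-applyUpTo (suc n) g G = cong (G (g 0) +_) (∑-applyUpTo n (λ a → g (suc a)) G)

  infix 4 _≤v_
  _≤v_ : ∀ {N} → Vec ℕ N → Vec ℕ N → Set
  _≤v_ = Pointwise _≤_

  infixl 6 _⊖_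
  _⊖_ : ∀ {N} → Vec ℕ N → Vec ℕ N → Vec ℕ N
  _⊖_ = Vec.zipWith _∸_

  infixr 7 _⊙_
  _⊙_ : ∀ {N} → ℕ → Vec ℕ N → Vec ℕ N
  c ⊙ u = Vec.map (c *_) u

  ≤v-trans : ∀ {N} {u v w : Vec ℕ N} → u ≤v v → v ≤v w → u ≤v w
  ≤v-trans = Pointwiseᵥ.trans ℕₚ.≤-trans

  ⊖-≤v : ∀ {N} (ℓ a : Vec ℕ N) → ℓ ⊖ a ≤v ℓ
  ⊖-≤v []      []      = []
  ⊖-≤v (x ∷ ℓ) (y ∷ a) = ℕₚ.m∸n≤m x y ∷ ⊖-≤v ℓ a

  ≤v-⊕ˡ : ∀ {N} (a b : Vec ℕ N) → a ≤v a ⊕ b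
  ≤v-⊕ˡ []      []      = []
  ≤v-⊕ˡ (x ∷ a) (y ∷ b) = ℕₚ.m≤m+n x y ∷ ≤v-⊕ˡ a b

  ≤v-⊕ʳ : ∀ {N} (a b : Vec ℕ N) → b ≤v a ⊕ b
  ≤v-⊕ʳ []      []      = []
  ≤v-⊕ʳ (x ∷ a) (y ∷ b) = ℕₚ.m≤n+m y x ∷ ≤v-⊕ʳ a b

  ≤v-⊙ : ∀ {N} c .{{_ : NonZero c}} (u : Vec ℕ N) → u ≤v c ⊙ u
  ≤v-⊙ c []      = []
  ≤v-⊙ c (x ∷ u) = ℕₚ.m≤n*m x c ∷ ≤v-⊙ c u

  ⊕-cancelˡ : ∀ {N} (a s ℓ : Vec ℕ N) → a ⊕ s ≡ ℓ → s ≡ ℓ ⊖ a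
  ⊕-cancelˡ []      []      []      _ = refl
  ⊕-cancelˡ (x ∷ a) (y ∷ s) (z ∷ ℓ) eq with Vecₚ.∷-injective eq
  ... | x+y≡z , a⊕s≡ℓ = cong₂ _∷_ (trans (sym (ℕₚ.m+n∸m≡n x y)) (cong (_∸ x) x+y≡z)) (⊕-cancelˡ a s ℓ a⊕s≡ℓ)

  ⊕-⊖ : ∀ {N} {a ℓ : Vec ℕ N} → a ≤v ℓ → a ⊕ (ℓ ⊖ a) ≡ ℓ
  ⊕-⊖ []          = refl
  ⊕-⊖ (x≤z ∷ a≤ℓ) = cong₂ _∷_ (ℕₚ.m+[n∸m]≡n x≤z) (⊕-⊖ a≤ℓ)

  ⊙-injective : ∀ {N} c .{{_ : NonZero c}} (u w : Vec ℕ N) → c ⊙ u ≡ c ⊙ w → u ≡ w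
  ⊙-injective c []      []      _  = refl
  ⊙-injective c (x ∷ u) (y ∷ w) eq with Vecₚ.∷-injective eq
  ... | cx≡cy , cu≡cw = cong₂ _∷_ (ℕₚ.*-cancelˡ-≡ x y c cx≡cy) (⊙-injective c u w cu≡cw)

  ⊙-distrib-⊕ : ∀ {N} c (a b : Vec ℕ N) → c ⊙ (a ⊕ b) ≡ (c ⊙ a) ⊕ (c ⊙ b)
  ⊙-distrib-⊕ c []      []      = refl
  ⊙-distrib-⊕ c (x ∷ a) (y ∷ b) = cong₂ _∷_ (ℕₚ.*-distribˡ-+ c x y) (⊙-distrib-⊕ c a b)

  ⊙-assoc : ∀ {N} c d (u : Vec ℕ N) → c ⊙ (d ⊙ u) ≡ (c * d) ⊙ u
  ⊙-assoc c d []      = refl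
  ⊙-assoc c d (x ∷ u) = cong₂ _∷_ (sym (ℕₚ.*-assoc c d x)) (⊙-assoc c d u)

  ⊙-identity : ∀ {N} (u : Vec ℕ N) → 1 ⊙ u ≡ u
  ⊙-identity []      = refl
  ⊙-identity (x ∷ u) = cong₂ _∷_ (ℕₚ.*-identityˡ x) (⊙-identity u)

  ⊙-zero : ∀ N c → c ⊙ Vec.replicate N 0 ≡ Vec.replicate N 0
  ⊙-zero zero    c = refl
  ⊙-zero (suc N) c = cong₂ _∷_ (ℕₚ.*-zeroʳ c) (⊙-zero N c)

  All-≤v-trans : ∀ {N k} {t : Vec (Vec ℕ N) k} {u w} → All (_≤v u) t → u ≤v w → All (_≤v w) t
  All-≤v-trans t≤u u≤w = All.map (λ a≤u → ≤v-trans a≤u u≤w) t≤u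

  vsum-bounds : ∀ {N k} (t : Vec (Vec ℕ N) k) → All (_≤v vsum t) t
  vsum-bounds []      = []
  vsum-bounds (a ∷ t) = ≤v-⊕ˡ a (vsum t) ∷ All-≤v-trans (vsum-bounds t) (≤v-⊕ʳ a (vsum t))

  ∑-box-[] : (h : Vec ℕ 0 → ℕ) → ∑ (box []) h ≡ h []
  ∑-box-[] h = ℕₚ.+-identityʳ (h [])

  ∑-box-∷ : ∀ {N} x (v : Vec ℕ N) h → ∑ (box (x ∷ v)) h ≡ ∑<[ a < suc x ] ∑[ u ∈ box v ] h (a ∷ u)
  ∑-box-∷ x v h = trans (∑-concatMap _∷_ (box v) (List.upTo (suc x)) h) (∑-applyUpTo (suc x) (λ a → a) _)

  ∑-box-cong : ∀ {N} (ℓ : Vec ℕ N) {h h′} → (∀ a → a ≤v ℓ → h a ≡ h′ a) → ∑ (box ℓ) h ≡ ∑ (box ℓ) h′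
  ∑-box-cong []      {h} {h′} h≗h′ = trans (∑-box-[] h) (trans (h≗h′ [] []) (sym (∑-box-[] h′)))
  ∑-box-cong (x ∷ v) {h} {h′} h≗h′ = begin
    ∑ (box (x ∷ v)) h                       ≡⟨ ∑-box-∷ x v h ⟩
    ∑<[ a < suc x ] ∑[ u ∈ box v ] h (a ∷ u)  ≡⟨ ∑<-cong (suc x) (λ a a≤x → ∑-box-cong v λ u u≤v → h≗h′ (a ∷ u) (ℕₚ.≤-pred a≤x ∷ u≤v)) ⟩
    ∑<[ a < suc x ] ∑[ u ∈ box v ] h′ (a ∷ u) ≡⟨ ∑-box-∷ x v h′ ⟨
    ∑ (box (x ∷ v)) h′                      ∎

  ∑-box-support : ∀ {N} {ℓ ℓ′ : Vec ℕ N} {h} → ℓ′ ≤v ℓ → (∀ m → ¬ m ≤v ℓ′ → h m ≡ 0) → ∑ (box ℓ) h ≡ ∑ (box ℓ′) h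
  ∑-box-support {ℓ = []}    {[]}     []            _   = refl
  ∑-box-support {ℓ = x ∷ v} {y ∷ w} {h} (y≤x ∷ w≤v) h≗0 = begin
    ∑ (box (x ∷ v)) h                       ≡⟨ ∑-box-∷ x v h ⟩
    ∑<[ a < suc x ] ∑[ u ∈ box v ] h (a ∷ u) ≡⟨ ∑<-cong (suc x) (λ a _ → ∑-box-support w≤v λ m m≰w → h≗0 (a ∷ m) λ{ (_ ∷ m≤w) → m≰w m≤w }) ⟩
    ∑<[ a < suc x ] ∑[ u ∈ box w ] h (a ∷ u) ≡⟨ ∑<-support y≤x (λ a y<a → ∑-zero (box w) λ m → h≗0 (a ∷ m) λ{ (a≤y ∷ _) → ℕₚ.<⇒≱ y<a a≤y }) ⟩
    ∑<[ a < suc y ] ∑[ u ∈ box w ] h (a ∷ u) ≡⟨ ∑-box-∷ y w h ⟨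
    ∑ (box (y ∷ w)) h                       ∎

  ∑-tuples-support : ∀ {N} k {ℓ ℓ′ : Vec ℕ N} {W} → ℓ′ ≤v ℓ → (∀ t → ¬ All (_≤v ℓ′) t → W t ≡ 0) →
                     ∑ (tuples k (box ℓ)) W ≡ ∑ (tuples k (box ℓ′)) W
  ∑-tuples-support zero    _     _   = refl
  ∑-tuples-support (suc k) {ℓ} {ℓ′} {W} ℓ′≤ℓ W≗0 = begin
    ∑ (tuples (suc k) (box ℓ)) W                          ≡⟨ ∑-tuples-suc k (box ℓ) W ⟩
    ∑[ a ∈ box ℓ ] ∑[ t ∈ tuples k (box ℓ) ] W (a ∷ t)
      ≡⟨ ∑-cong (box ℓ) (λ a → ∑-tuples-support k ℓ′≤ℓ λ t t≰ → W≗0 (a ∷ t) λ{ (_ ∷ t≤) → t≰ t≤ }) ⟩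
    ∑[ a ∈ box ℓ ] ∑[ t ∈ tuples k (box ℓ′) ] W (a ∷ t)
      ≡⟨ ∑-box-support ℓ′≤ℓ (λ a a≰ → ∑-zero (tuples k (box ℓ′)) λ t → W≗0 (a ∷ t) λ{ (a≤ ∷ _) → a≰ a≤ }) ⟩
    ∑[ a ∈ box ℓ′ ] ∑[ t ∈ tuples k (box ℓ′) ] W (a ∷ t) ≡⟨ ∑-tuples-suc k (box ℓ′) W ⟨
    ∑ (tuples (suc k) (box ℓ′)) W                         ∎

  -- ℓ ⊖ a never truncates, as a ranges over box ℓ.
  infixl 7 _⋆_
  _⋆_ : ∀ {N} → (Vec ℕ N → ℕ) → (Vec ℕ N → ℕ) → Vec ℕ N → ℕ
  (F ⋆ G) ℓ = ∑[ a ∈ box ℓ ] F a * G (ℓ ⊖ a)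

  δ : ∀ {N} → Vec ℕ N → ℕ
  δ {N} ℓ = 𝟙[ Vec.replicate N 0 ≟v ℓ ]

  δ-zero∷ : ∀ {N} (v : Vec ℕ N) → δ (0 ∷ v) ≡ δ v
  δ-zero∷ {N} v = 𝟙-cong (Vec.replicate (suc N) 0 ≟v (0 ∷ v)) (Vec.replicate N 0 ≟v v) Vecₚ.∷-injectiveʳ (cong (0 ∷_))

  δ-suc∷ : ∀ {N} a (v : Vec ℕ N) → δ (suc a ∷ v) ≡ 0
  δ-suc∷ {N} a v = 𝟙-reject (Vec.replicate (suc N) 0 ≟v (suc a ∷ v)) (λ eq → ℕₚ.0≢1+n (Vecₚ.∷-injectiveˡ eq))

  ∑-tuples-peel : ∀ {N k} {a ℓ : Vec ℕ N} → a ≤v ℓ → (Φ : Vec (Vec ℕ N) k → Vec ℕ N) (Q : Vec (Vec ℕ N) k → ℕ) (c : ℕ) →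
    ∑[ t ∈ tuples k (box ℓ) ] 𝟙[ (a ⊕ Φ t) ≟v ℓ ] * (c * Q t) ≡ c * (∑[ t ∈ tuples k (box ℓ) ] 𝟙[ Φ t ≟v (ℓ ⊖ a) ] * Q t)
  ∑-tuples-peel {k = k} {a} {ℓ} a≤ℓ Φ Q c = trans (∑-cong (tuples k (box ℓ)) reorder) (∑-*ˡ (tuples k (box ℓ)) c _)
    where
    reorder : ∀ t → 𝟙[ (a ⊕ Φ t) ≟v ℓ ] * (c * Q t) ≡ c * (𝟙[ Φ t ≟v (ℓ ⊖ a) ] * Q t)
    reorder t rewrite 𝟙-cong ((a ⊕ Φ t) ≟v ℓ) (Φ t ≟v (ℓ ⊖ a)) (⊕-cancelˡ a (Φ t) ℓ) (λ Φt≡ℓ⊖a → trans (cong (a ⊕_) Φt≡ℓ⊖a) (⊕-⊖ a≤ℓ)) =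
      x∙yz≈y∙xz (𝟙[ Φ t ≟v (ℓ ⊖ a) ]) c (Q t)

  ∏ : ∀ {A : Set} {k} → (A → ℕ) → Vec A k → ℕ
  ∏ f t = product (Vec.toList (Vec.map f t))

  module _ {N} (f : Vec ℕ N → ℕ) where

    binom-∑ : ∀ k ℓ → binom f k ℓ ≡ ∑[ t ∈ tuples k (box ℓ) ] 𝟙[ vsum t ≟v ℓ ] * ∏ f t
    binom-∑ k ℓ = ∑-filter (λ t → vsum t ≟v ℓ) (tuples k (box ℓ)) _

    binom-zero : ∀ ℓ → binom f 0 ℓ ≡ δ ℓ
    binom-zero ℓ = trans (binom-∑ 0 ℓ) (trans (ℕₚ.+-identityʳ _) (ℕₚ.*-identityʳ _))

    binom-suc : ∀ k ℓ → binom f (suc k) ℓ ≡ (f ⋆ binom f k) ℓ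
    binom-suc k ℓ = begin
      binom f (suc k) ℓ
        ≡⟨ trans (binom-∑ (suc k) ℓ) (∑-tuples-suc k (box ℓ) _) ⟩
      ∑[ a ∈ box ℓ ] ∑[ t ∈ tuples k (box ℓ) ] 𝟙[ (a ⊕ vsum t) ≟v ℓ ] * (f a * ∏ f t)
        ≡⟨ ∑-box-cong ℓ (λ a a≤ℓ → ∑-tuples-peel {k = k} a≤ℓ vsum (∏ f) (f a)) ⟩
      ∑[ a ∈ box ℓ ] f a * (∑[ t ∈ tuples k (box ℓ) ] 𝟙[ vsum t ≟v (ℓ ⊖ a) ] * ∏ f t)
        ≡⟨ ∑-cong (box ℓ) (λ a → cong (f a *_) (∑-tuples-support k (⊖-≤v ℓ a) (outside a))) ⟩
      ∑[ a ∈ box ℓ ] f a * (∑[ t ∈ tuples k (box (ℓ ⊖ a)) ] 𝟙[ vsum t ≟v (ℓ ⊖ a) ] * ∏ f t)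
        ≡⟨ ∑-cong (box ℓ) (λ a → cong (f a *_) (binom-∑ k (ℓ ⊖ a))) ⟨
      (f ⋆ binom f k) ℓ ∎
      where
      outside : ∀ a t → ¬ All (_≤v ℓ ⊖ a) t → 𝟙[ vsum t ≟v (ℓ ⊖ a) ] * ∏ f t ≡ 0
      outside a t t≰ = cong (_* ∏ f t) (𝟙-reject (vsum t ≟v (ℓ ⊖ a)) λ t≡ → t≰ (subst (λ u → All (_≤v u) t) t≡ (vsum-bounds t)))

  module Lucas (p : ℕ) .{{_ : NonZero p}} where

    open Dilation p

    horner : ∀ {N n} → Vec (Vec ℕ N) n → Vec ℕ N
    horner {N} []       = Vec.replicate N 0
    horner     (m ∷ ms) = m ⊕ (p ⊙ horner ms)

    hornerℕ : ∀ {n} → Vec ℕ n → ℕ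
    hornerℕ []       = 0
    hornerℕ (k ∷ ks) = k + p * hornerℕ ks

    horner-bounds : ∀ {N n} (ms : Vec (Vec ℕ N) n) → All (_≤v horner ms) ms
    horner-bounds []       = []
    horner-bounds (m ∷ ms) = ≤v-⊕ˡ m _ ∷ All-≤v-trans (horner-bounds ms) (≤v-trans (≤v-⊙ p (horner ms)) (≤v-⊕ʳ m _))

    dilateᵛ : ∀ {N} → (Vec ℕ N → ℕ) → Vec ℕ N → ℕ
    dilateᵛ {zero}  g []      = g []
    dilateᵛ {suc N} g (a ∷ v) = dilate 0 (λ b → dilateᵛ (λ u → g (b ∷ u)) v) a

    dilateᵛ-view : ∀ {N} g (w : Vec ℕ N) → (∃ λ u → w ≡ p ⊙ u × dilateᵛ g w ≡ g u) ⊎ ((∀ u → w ≢ p ⊙ u) × dilateᵛ g w ≡ 0)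
    dilateᵛ-view {zero}  g []      = inj₁ ([] , refl , refl)
    dilateᵛ-view {suc N} g (a ∷ v) with dilate-view 0 (λ b → dilateᵛ (λ u → g (b ∷ u)) v) a
    ... | inj₂ (p∤a , value) = inj₂ ((λ { (b ∷ u) eq → p∤a (divides b (trans (Vecₚ.∷-injectiveˡ eq) (ℕₚ.*-comm p b))) }) , value)
    ... | inj₁ (b , a≡b*p , value) with dilateᵛ-view (λ u → g (b ∷ u)) v
    ...   | inj₁ (u , v≡p⊙u , value′)    = inj₁ (b ∷ u , cong₂ _∷_ (trans a≡b*p (ℕₚ.*-comm b p)) v≡p⊙u , trans value value′)
    ...   | inj₂ (v-nonmultiple , value′) = inj₂ ((λ { (_ ∷ u) eq → v-nonmultiple u (Vecₚ.∷-injectiveʳ eq) }) , trans value value′)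

    private
      horner-step : ∀ k c q h → k * c + q * c * h ≡ c * (k + q * h)
      horner-step = solve-∀

    digits-offset : ∀ {m n} (g : Fin n → Fin m) d → (∀ i → toℕ (g i) ≡ d + toℕ i) → (ks : Vec ℕ n) →
      sum (Vec.toList (Vec.zipWith (λ i a → a * p ^ toℕ i) (Vec.tabulate g) ks)) ≡ p ^ d * hornerℕ ks
    digits-offset g d offset []       = sym (ℕₚ.*-zeroʳ (p ^ d))
    digits-offset g d offset (k ∷ ks) = begin
      k * p ^ toℕ (g Fin.zero) + sum (Vec.toList (Vec.zipWith _ (Vec.tabulate (λ i → g (Fin.suc i))) ks))
        ≡⟨ cong₂ (λ e s → k * p ^ e + s) (trans (offset Fin.zero) (ℕₚ.+-identityʳ d))
                 (digits-offset (λ i → g (Fin.suc i)) (suc d) (λ i → trans (offset (Fin.suc i)) (ℕₚ.+-suc d (toℕ i))) ks) ⟩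
      k * p ^ d + p * p ^ d * hornerℕ ks ≡⟨ horner-step k (p ^ d) p (hornerℕ ks) ⟩
      p ^ d * hornerℕ (k ∷ ks) ∎

    digitValue≡hornerℕ : ∀ {r} (ks : Vec ℕ (suc r)) → digitValue p ks ≡ hornerℕ ks
    digitValue≡hornerℕ ks = trans (digits-offset (λ i → i) 0 (λ _ → refl) ks) (ℕₚ.*-identityˡ (hornerℕ ks))

    weights-offset : ∀ {N m n} (g : Fin n → Fin m) d → (∀ i → toℕ (g i) ≡ d + toℕ i) → (ms : Vec (Vec ℕ N) n) →
      vsum (Vec.zipWith (λ i m → Vec.map (p ^ toℕ i *_) m) (Vec.tabulate g) ms) ≡ p ^ d ⊙ horner ms
    weights-offset {N} g d offset [] = sym (⊙-zero N (p ^ d))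
    weights-offset g d offset (m ∷ ms) = begin
      Vec.map (p ^ toℕ (g Fin.zero) *_) m ⊕ vsum (Vec.zipWith _ (Vec.tabulate (λ i → g (Fin.suc i))) ms)
        ≡⟨ cong₂ (λ e s → Vec.map (p ^ e *_) m ⊕ s) (trans (offset Fin.zero) (ℕₚ.+-identityʳ d))
                 (weights-offset (λ i → g (Fin.suc i)) (suc d) (λ i → trans (offset (Fin.suc i)) (ℕₚ.+-suc d (toℕ i))) ms) ⟩
      (p ^ d ⊙ m) ⊕ ((p * p ^ d) ⊙ horner ms)
        ≡⟨ cong ((p ^ d ⊙ m) ⊕_) (trans (cong (_⊙ horner ms) (ℕₚ.*-comm p (p ^ d))) (sym (⊙-assoc (p ^ d) p (horner ms)))) ⟩
      (p ^ d ⊙ m) ⊕ (p ^ d ⊙ (p ⊙ horner ms)) ≡⟨ ⊙-distrib-⊕ (p ^ d) m (p ⊙ horner ms) ⟨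
      p ^ d ⊙ horner (m ∷ ms) ∎

    weightedSum≡horner : ∀ {N r} (ms : Vec (Vec ℕ N) (suc r)) → weightedSum p ms ≡ horner ms
    weightedSum≡horner ms = trans (weights-offset (λ i → i) 0 (λ _ → refl) ms) (⊙-identity (horner ms))

    module _ {N} (f : Vec ℕ N → ℕ) where

      lucasSum : ∀ {n} → Vec ℕ n → Vec ℕ N → ℕ
      lucasSum []       = δ
      lucasSum (k ∷ ks) = binom f k ⋆ dilateᵛ (lucasSum ks)

      ∏binom : ∀ {n} → Vec ℕ n → Vec (Vec ℕ N) n → ℕ
      ∏binom ks ms = product (Vec.toList (Vec.zipWith (binom f) ks ms))

      ∑-dilated : ∀ {n} (ks : Vec ℕ n) {L : Vec ℕ N → ℕ} →
                  (∀ u → ∑[ ms ∈ tuples n (box u) ] 𝟙[ horner ms ≟v u ] * ∏binom ks ms ≡ L u) →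
                  ∀ {ℓ} w → w ≤v ℓ → ∑[ ms ∈ tuples n (box ℓ) ] 𝟙[ (p ⊙ horner ms) ≟v w ] * ∏binom ks ms ≡ dilateᵛ L w
      ∑-dilated {n} ks {L} ∑≡L {ℓ} w w≤ℓ with dilateᵛ-view L w
      ... | inj₁ (u , refl , value) = begin
        ∑[ ms ∈ tuples n (box ℓ) ] 𝟙[ (p ⊙ horner ms) ≟v (p ⊙ u) ] * ∏binom ks ms
          ≡⟨ ∑-cong (tuples n (box ℓ)) (λ ms → cong (_* ∏binom ks ms)
               (𝟙-cong ((p ⊙ horner ms) ≟v (p ⊙ u)) (horner ms ≟v u) (⊙-injective p _ _) (cong (p ⊙_)))) ⟩
        ∑[ ms ∈ tuples n (box ℓ) ] 𝟙[ horner ms ≟v u ] * ∏binom ks ms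
          ≡⟨ ∑-tuples-support n (≤v-trans (≤v-⊙ p u) w≤ℓ) outside ⟩
        ∑[ ms ∈ tuples n (box u) ] 𝟙[ horner ms ≟v u ] * ∏binom ks ms
          ≡⟨ ∑≡L u ⟩
        L u
          ≡⟨ value ⟨
        dilateᵛ L (p ⊙ u) ∎
        where
        outside : ∀ ms → ¬ All (_≤v u) ms → 𝟙[ horner ms ≟v u ] * ∏binom ks ms ≡ 0
        outside ms ms≰u = cong (_* ∏binom ks ms) (𝟙-reject (horner ms ≟v u)
          λ h≡u → ms≰u (subst (λ v → All (_≤v v) ms) h≡u (horner-bounds ms)))
      ... | inj₂ (nonmultiple , value) =
        trans (∑-zero (tuples n (box ℓ)) λ ms → cong (_* ∏binom ks ms)
                (𝟙-reject ((p ⊙ horner ms) ≟v w) λ eq → nonmultiple (horner ms) (sym eq)))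
              (sym value)

      ∑-horner : ∀ {n} (ks : Vec ℕ n) ℓ → ∑[ ms ∈ tuples n (box ℓ) ] 𝟙[ horner ms ≟v ℓ ] * ∏binom ks ms ≡ lucasSum ks ℓ
      ∑-horner []       ℓ = trans (ℕₚ.+-identityʳ _) (ℕₚ.*-identityʳ _)
      ∑-horner {suc n} (k ∷ ks) ℓ = begin
        ∑ (tuples (suc n) (box ℓ)) _
          ≡⟨ ∑-tuples-suc n (box ℓ) _ ⟩
        ∑[ a ∈ box ℓ ] ∑[ ms ∈ tuples n (box ℓ) ] 𝟙[ (a ⊕ (p ⊙ horner ms)) ≟v ℓ ] * (binom f k a * ∏binom ks ms)
          ≡⟨ ∑-box-cong ℓ (λ a a≤ℓ → ∑-tuples-peel {k = n} a≤ℓ (λ ms → p ⊙ horner ms) (∏binom ks) (binom f k a)) ⟩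
        ∑[ a ∈ box ℓ ] binom f k a * (∑[ ms ∈ tuples n (box ℓ) ] 𝟙[ (p ⊙ horner ms) ≟v (ℓ ⊖ a) ] * ∏binom ks ms)
          ≡⟨ ∑-cong (box ℓ) (λ a → cong (binom f k a *_) (∑-dilated ks (∑-horner ks) (ℓ ⊖ a) (⊖-≤v ℓ a))) ⟩
        (binom f k ⋆ dilateᵛ (lucasSum ks)) ℓ ∎

      lucasRHS≡lucasSum : ∀ {r} (ks : Vec ℕ (suc r)) ℓ → lucasRHS f p ks ℓ ≡ lucasSum ks ℓ
      lucasRHS≡lucasSum {r} ks ℓ = begin
        lucasRHS f p ks ℓ
          ≡⟨ ∑-filter (λ ms → weightedSum p ms ≟v ℓ) (tuples (suc r) (box ℓ)) (∏binom ks) ⟩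
        ∑[ ms ∈ tuples (suc r) (box ℓ) ] 𝟙[ weightedSum p ms ≟v ℓ ] * ∏binom ks ms
          ≡⟨ ∑-cong (tuples (suc r) (box ℓ)) (λ ms → cong (_* ∏binom ks ms) (cong (λ w → 𝟙[ w ≟v ℓ ]) (weightedSum≡horner ms))) ⟩
        ∑[ ms ∈ tuples (suc r) (box ℓ) ] 𝟙[ horner ms ≟v ℓ ] * ∏binom ks ms
          ≡⟨ ∑-horner ks ℓ ⟩
        lucasSum ks ℓ ∎

module GeneratingSeries {p : ℕ} (isPrime : Prime p) where

  private instance p≢0 = prime⇒nonZero isPrime
  open MultivariateSeries isPrime
  open Dilation p
  open Lucas p

  series : ∀ {N} → (Vec ℕ N → ℕ) → 𝔽.Carrier N
  series {zero}  F   = F []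
  series {suc N} F a = series (λ v → F (a ∷ v))

  series-cong : ∀ {N} {F G : Vec ℕ N → ℕ} → (∀ u → F u ≡ G u) → 𝔽._≈_ N (series F) (series G)
  series-cong {zero}  F≗G   = ≡.cong (_% p) (F≗G [])
  series-cong {suc N} F≗G a = series-cong {N} (λ v → F≗G (a ∷ v))

  series-0 : ∀ {N} → 𝔽._≈_ N (series {N} (λ _ → 0)) (𝔽.0# N)
  series-0 {zero}    = ≡.refl
  series-0 {suc N} a = series-0 {N}

  series-+ : ∀ {N} (F G : Vec ℕ N → ℕ) → 𝔽._≈_ N (series (λ u → F u ℕ.+ G u)) (𝔽._+_ N (series F) (series G))
  series-+ {zero}  F G   = ≡.refl
  series-+ {suc N} F G a = series-+ (λ v → F (a ∷ v)) (λ v → G (a ∷ v))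

  series-∑< : ∀ {N} n (H : ℕ → Vec ℕ N → ℕ) →
              𝔽._≈_ N (series (λ u → ∑<[ a < n ] H a u)) (RangeSum.∑< (𝔽.+-monoid N) n (λ a → series (H a)))
  series-∑< {N} zero    H = series-0 {N}
  series-∑< {N} (suc n) H = 𝔽.trans N (series-+ (H 0) _) (𝔽.+-congˡ N (series-∑< n (λ a → H (suc a))))

  series-⋆ : ∀ {N} (F G : Vec ℕ N → ℕ) → 𝔽._≈_ N (series (F ⋆ G)) (𝔽._*_ N (series F) (series G))
  series-⋆ {zero}  F G   = ≡.cong (_% p) (ℕₚ.+-identityʳ (F [] ℕ.* G []))
  series-⋆ {suc N} F G x = begin
    series (λ v → (F ⋆ G) (x ∷ v))
      ≈⟨ series-cong {N} (λ v → ∑-box-∷ x v (λ u → F u ℕ.* G ((x ∷ v) ⊖ u))) ⟩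
    series (λ v → ∑<[ a < suc x ] (Fₐ a ⋆ G₋ a) v)
      ≈⟨ series-∑< (suc x) (λ a → Fₐ a ⋆ G₋ a) ⟩
    Σ.∑< (suc x) (λ a → series (Fₐ a ⋆ G₋ a))
      ≈⟨ Σ.∑<-cong (suc x) (λ a _ → series-⋆ (Fₐ a) (G₋ a)) ⟩
    Σ.∑< (suc x) (λ a → series F a * series G (x ∸ a))
      ≈⟨ *ₛ-coefficient (series F) (series G) x ⟨
    (series F *ₛ series G) x ∎
    where
    open 𝔽 N
    module Σ = RangeSum +-monoid
    open PowerSeries 𝔽[[ N ]] using (_*ₛ_; *ₛ-coefficient)
    open import Relation.Binary.Reasoning.Setoid setoid
    Fₐ G₋ : ℕ → Vec ℕ N → ℕ
    Fₐ a u = F (a ∷ u)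
    G₋ a u = G ((x ∸ a) ∷ u)

  series-δ : ∀ {N} → 𝔽._≈_ N (series {N} δ) (𝔽.1# N)
  series-δ {zero}          = ≡.refl
  series-δ {suc N} zero    = 𝔽.trans N (series-cong {N} δ-zero∷) (series-δ {N})
  series-δ {suc N} (suc a) = 𝔽.trans N (series-cong {N} (δ-suc∷ a)) (series-0 {N})

  series-dilateᵛ : ∀ {N} (g : Vec ℕ N → ℕ) → 𝔽._≈_ N (series (dilateᵛ g)) (frobenius N (series g))
  series-dilateᵛ {zero}  g   = ≡.refl
  series-dilateᵛ {suc N} g a = 𝔽.trans N
    (𝔽.reflexive N (dilate-pointwise 0 (λ b → dilateᵛ (λ u → g (b ∷ u))) series a))
    (dilate-cong (𝔽._≈_ N) (series-0 {N}) (λ b → series-dilateᵛ (λ u → g (b ∷ u))) a)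

  series-coefficient : ∀ {N} {F G : Vec ℕ N → ℕ} → 𝔽._≈_ N (series F) (series G) → ∀ ℓ → F ℓ % p ≡ G ℓ % p
  series-coefficient {zero}  F≈G []      = F≈G
  series-coefficient {suc N} F≈G (x ∷ v) = series-coefficient {N} (F≈G x) v

  module _ {N} (f : Vec ℕ N → ℕ) where

    open 𝔽 N
    open import Relation.Binary.Reasoning.Setoid setoid

    series-binom : ∀ k → series (binom f k) ≈ series f ^ k
    series-binom zero    = trans (series-cong {N} (binom-zero f)) (series-δ {N})
    series-binom (suc k) = begin
      series (binom f (suc k))          ≈⟨ series-cong {N} (binom-suc f k) ⟩
      series (f ⋆ binom f k)            ≈⟨ series-⋆ f (binom f k) ⟩
      series f * series (binom f k)     ≈⟨ *-congˡ (series-binom k) ⟩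
      series f * series f ^ k           ∎

    series-lucasSum : ∀ {n} (ks : Vec ℕ n) → series (lucasSum f ks) ≈ series f ^ hornerℕ ks
    series-lucasSum []       = series-δ {N}
    series-lucasSum (k ∷ ks) = begin
      series (binom f k ⋆ dilateᵛ (lucasSum f ks))           ≈⟨ series-⋆ (binom f k) _ ⟩
      series (binom f k) * series (dilateᵛ (lucasSum f ks))  ≈⟨ *-cong (series-binom k) (series-dilateᵛ (lucasSum f ks)) ⟩
      F ^ k * frobenius N (series (lucasSum f ks))           ≈⟨ *-congˡ (^p≈frobenius N _) ⟨
      F ^ k * series (lucasSum f ks) ^ p                     ≈⟨ *-congˡ (^-congˡ p (series-lucasSum ks)) ⟩
      F ^ k * (F ^ hornerℕ ks) ^ p                           ≈⟨ *-congˡ (^-assocʳ F (hornerℕ ks) p) ⟩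
      F ^ k * F ^ (hornerℕ ks ℕ.* p)                         ≈⟨ ^-homo-* F k _ ⟨
      F ^ (k ℕ.+ hornerℕ ks ℕ.* p)                           ≡⟨ ≡.cong (λ e → F ^ (k ℕ.+ e)) (ℕₚ.*-comm (hornerℕ ks) p) ⟩
      F ^ hornerℕ (k ∷ ks)                                   ∎
      where F = series f

theorem13 : (N : ℕ) → 1 ≤ N → (f : Vec ℕ N → ℕ) → (p : ℕ) → .{{_ : NonZero p}} → Prime p →
    (r : ℕ) → (ks : Vec ℕ (suc r)) → All (_< p) ks → (k : ℕ) → k ≡ digitValue p ks →
    (ℓ : Vec ℕ N) →
    binom f k ℓ % p ≡ lucasRHS f p ks ℓ % p
theorem13 N _ f p isPrime r ks _ k k≡digits = series-coefficient (begin
  series (binom f k)             ≈⟨ series-binom f k ⟩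
  series f ^ k                   ≡⟨ ≡.cong (series f ^_) (≡.trans k≡digits (digitValue≡hornerℕ ks)) ⟩
  series f ^ hornerℕ ks          ≈⟨ series-lucasSum f ks ⟨
  series (lucasSum f ks)         ≈⟨ series-cong {N} (λ ℓ → ≡.sym (lucasRHS≡lucasSum f ks ℓ)) ⟩
  series (lucasRHS f p ks)       ∎)
  where
  open GeneratingSeries isPrime
  open MultivariateSeries isPrime using (module 𝔽)
  open 𝔽 N using (setoid; _^_)
  open Lucas p {{prime⇒nonZero isPrime}}
  open import Relation.Binary.Reasoning.Setoid setoid
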